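{- Let $G$ be a connected strongly regular graph with parameters $(n,k,0,\mu)$, with $k\geq 3$. Then the Gallai graph $\Gamma(G)$ is connected and edge-regular. Moreover, $\Gamma(G)$ is strongly regular if and only if the following conditions hold: (1) if $\mu=1$, then any two non-adjacent edges of $G$ belong to a common cycle of length $5$ in $G$; (2) if $\mu>1$, then any two non-adjacent edges of $G$ belong to a common cycle of length $4$ in $G$.
   Context: All graphs are finite and simple. A $k$-regular graph $G$ on $n$ vertices is strongly regular with parameters $(n,k,\lambda,\mu)$ if $G$ is neither complete nor empty, any two adjacent vertices have exactly $\lambda$ common neighbours, and any two non-adjacent vertices have exactly $\mu$ common neighbours. An edge-regular graph with parameters $(n,k,\lambda)$ is a $k$-regular graph on $n$ vertices in which any two adjacent vertices have exactly $\lambda$ common neighbours. The Gallai graph $\Gamma(G)$ has the edges of $G$ as vertices, two being adjacent iff the corresponding edges of $G$ share a vertex but do not lie on a common triangle of $G$. Two edges of $G$ are non-adjacent if they share no endpoint; two edges belong to a common cycle of length $m$ if some cycle subgraph $C_m$ of $G$ contains both. -}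

module Defs where

open import Data.Nat as ℕ using (ℕ; zero; suc; NonZero)
open import Data.Nat.DivMod using (_%_; m%n<n)
open import Data.Fin as Fin using (Fin; toℕ; fromℕ<; _≟_)
open import Data.Bool using (Bool; true; false; T; _∧_; _∨_; not)
open import Data.Product using (Σ; _×_; _,_; ∃; ∃-syntax)
open import Data.Sum using (_⊎_)
open import Relation.Binary.PropositionalEquality using (_≡_; _≢_)
open import Relation.Nullary.Decidable using (⌊_⌋)
open import Function.Bundles using (_↔_)
open import Data.Empty using (⊥)

Adjacency : Set → Set
Adjacency V = V → V → Bool

IsSimpleGraph : ∀ {V : Set} → Adjacency V → Set
IsSimpleGraph {V} adj = (∀ u v → adj u v ≡ adj v u) × (∀ v → adj v v ≡ false)

HasSize : Set → ℕ → Set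
HasSize A m = A ↔ Fin m

IsRegular : ∀ {V : Set} → Adjacency V → ℕ → Set
IsRegular {V} adj k = ∀ v → HasSize (Σ V (λ w → T (adj v w))) k

CommonNbrs : ∀ {V : Set} → Adjacency V → V → V → Set
CommonNbrs {V} adj u v = Σ V (λ w → T (adj u w ∧ adj v w))

IsComplete : ∀ {V : Set} → Adjacency V → Set
IsComplete {V} adj = ∀ (u v : V) → u ≢ v → T (adj u v)

IsEmpty : ∀ {V : Set} → Adjacency V → Set
IsEmpty {V} adj = ∀ (u v : V) → adj u v ≡ false

IsStronglyRegular : ∀ {V : Set} → Adjacency V → ℕ → ℕ → ℕ → ℕ → Set
IsStronglyRegular {V} adj n k l m =
  HasSize V n × IsRegular adj k
  × (IsComplete adj → ⊥) × (IsEmpty adj → ⊥)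
  × (∀ u v → T (adj u v) → HasSize (CommonNbrs adj u v) l)
  × (∀ u v → u ≢ v → adj u v ≡ false → HasSize (CommonNbrs adj u v) m)

IsEdgeRegular : ∀ {V : Set} → Adjacency V → ℕ → ℕ → ℕ → Set
IsEdgeRegular {V} adj n k l =
  HasSize V n × IsRegular adj k
  × (∀ u v → T (adj u v) → HasSize (CommonNbrs adj u v) l)

data Reachable {V : Set} (adj : Adjacency V) : V → V → Set where
  here : ∀ {u} → Reachable adj u u
  step : ∀ {u v w} → T (adj u v) → Reachable adj v w → Reachable adj u w

IsConnected : ∀ {V : Set} → Adjacency V → Set
IsConnected {V} adj = ∀ (u v : V) → Reachable adj u v

Edge : ∀ {n} → Adjacency (Fin n) → Set
Edge {n} adj = Σ (Fin n) λ u → Σ (Fin n) λ v → (u Fin.< v) × T (adj u v)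

src tgt : ∀ {n} {adj : Adjacency (Fin n)} → Edge adj → Fin n
src (u , _ , _ , _) = u
tgt (_ , v , _ , _) = v

_==_ : ∀ {n} → Fin n → Fin n → Bool
a == b = ⌊ a ≟ b ⌋

anyFin : ∀ {n} → (Fin n → Bool) → Bool
anyFin {zero} p = false
anyFin {suc n} p = p Fin.zero ∨ anyFin (λ i → p (Fin.suc i))

edgeJoins : ∀ {n} {adj : Adjacency (Fin n)} → Edge adj → Fin n → Fin n → Bool
edgeJoins e x y = (src e == x ∧ tgt e == y) ∨ (src e == y ∧ tgt e == x)

shareVertex : ∀ {n} {adj : Adjacency (Fin n)} → Edge adj → Edge adj → Bool
shareVertex e f =
  not (src e == src f ∧ tgt e == tgt f)
  ∧ (src e == src f ∨ src e == tgt f ∨ tgt e == src f ∨ tgt e == tgt f)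

commonTriangle : ∀ {n} (adj : Adjacency (Fin n)) → Edge adj → Edge adj → Bool
commonTriangle adj e f =
  anyFin λ x → anyFin λ y → anyFin λ z →
    adj x y ∧ adj y z ∧ adj x z
    ∧ (edgeJoins e x y ∨ edgeJoins e y z ∨ edgeJoins e x z)
    ∧ (edgeJoins f x y ∨ edgeJoins f y z ∨ edgeJoins f x z)

gallai : ∀ {n} (adj : Adjacency (Fin n)) → Adjacency (Edge adj)
gallai adj e f = shareVertex e f ∧ not (commonTriangle adj e f)

NonAdjacentEdges : ∀ {n} {adj : Adjacency (Fin n)} → Edge adj → Edge adj → Set
NonAdjacentEdges e f =
  (src e ≢ src f) × (src e ≢ tgt f) × (tgt e ≢ src f) × (tgt e ≢ tgt f)

next : ∀ {m} .{{_ : NonZero m}} → Fin m → Fin m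
next {m} i = fromℕ< (m%n<n (suc (toℕ i)) m)

record Cycle {n} (adj : Adjacency (Fin n)) (m : ℕ) .{{_ : NonZero m}} : Set where
  field
    vert      : Fin m → Fin n
    injective : ∀ i j → vert i ≡ vert j → i ≡ j
    adjacent  : ∀ i → T (adj (vert i) (vert (next i)))

OnCycle : ∀ {n} {adj : Adjacency (Fin n)} {m} .{{_ : NonZero m}} →
          Cycle adj m → Edge adj → Set
OnCycle {m = m} c e = ∃[ i ] T (edgeJoins e (Cycle.vert c i) (Cycle.vert c (next i)))

InCommonCycle : ∀ {n} (adj : Adjacency (Fin n)) (m : ℕ) .{{_ : NonZero m}} →
                Edge adj → Edge adj → Set
InCommonCycle adj m e f = Σ (Cycle adj m) λ c → OnCycle c e × OnCycle c f

-- Since λ = 0, G is triangle-free, so two edges are adjacent in Γ(G) exactly when they share an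
-- endpoint. Hence Γ(G) is connected with G, an edge x y has the 2(k − 1) other edges at x or at y as
-- Γ-neighbours, and two edges at x have the k − 2 other edges at x as common Γ-neighbours.
-- The common Γ-neighbours of disjoint edges x x′, y y′ are the edges between their ends; if x ~ y,
-- triangle-freeness leaves only x y and possibly x′ y′, so there are 1 + [x′ ~ y′] of them.
-- Γ(G) is therefore strongly regular iff this number is the same for all disjoint pairs. It is 1 for the
-- end edges of a path w v₁ u v₂ when μ = 1 (x′ ~ y′ would give x and y′ two common neighbours x′, y),
-- and 2 for a pair v₁ z₁, z₂ v₂ with z₁, z₂ common neighbours of v₁, v₂ when μ > 1. A single edge x y
-- closes up through the common neighbour of x′ and y′ to a 5-cycle, two edges form a 4-cycle; conversely
-- two disjoint edges on a 4- or 5-cycle are at distance at most 2 along it, hence joined by cycle edges.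

module Submission where

open import Defs
open import Data.Nat using (ℕ; zero; suc; _+_; _≤_; _<_; s≤s; NonZero)
open import Data.Nat.Properties using (+-identityʳ; suc-injective; n<1⇒n≡0)
import Data.Nat.Properties as ℕ
open import Data.Fin using (Fin; zero; suc; punchIn; punchOut; _≟_)
open import Data.Fin.Patterns using (0F; 1F; 2F; 3F; 4F)
open import Data.Fin.Permutation using (↔⇒≡)
open import Data.Fin.Properties
  using (¬Fin0; 0≢1+n; 0↔⊥; 1↔⊤; 2↔Bool; +↔⊎; *↔×; all?; <-cmp; <-irrelevant; <-asym; _<?_;
         punchInᵢ≢i; punchOut-cong; punchOut-punchIn; punchIn-punchOut)
open import Data.Bool using (Bool; true; false; T; not; _∧_; _∨_; if_then_else_)
open import Data.Bool.Properties using (T-irrelevant; T-∧; T-∨; T-≡; T-not-≡; ∧-identityʳ)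
open import Data.Empty using (⊥; ⊥-elim)
open import Data.Product using (Σ; _,_; proj₁; proj₂; _×_; ∃-syntax)
open import Data.Product.Function.NonDependent.Propositional using (_×-↔_)
open import Data.Sum using (_⊎_; inj₁; inj₂; [_,_])
open import Data.Sum.Function.Propositional using (_⊎-↔_)
open import Function using (_∘_)
open import Function.Bundles using (Equivalence; Injection; Inverse; _↔_; _⇔_; mk⇔; mk↔ₛ′; mk⤖)
open import Function.Consequences.Propositional using (strictlySurjective⇒surjective)
open import Function.Definitions using (Injective; StrictlySurjective)
open import Function.Properties.Bijection using (⤖⇒↔)
open import Function.Properties.Inverse using (↔-sym; ↔-trans; Inverse⇒Injection)
open import Relation.Binary using (tri<; tri≈; tri>)
open import Relation.Binary.PropositionalEquality using (_≡_; _≢_; refl; sym; trans; cong; cong₂; subst)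
open import Relation.Nullary using (Dec; yes; no; ¬_)
open import Relation.Nullary.Decidable
  using (⌊_⌋; toWitness; fromWitness; toWitnessFalse; fromWitnessFalse; _⊎-dec_)

¬T⇒≡false : ∀ {b} → ¬ T b → b ≡ false
¬T⇒≡false {false} _  = refl
¬T⇒≡false {true}  ¬t = ⊥-elim (¬t _)

-- T-∧ and T-∨ with the left operand explicit: it cannot be inferred through T.
T-∧-elim : ∀ a {b} → T (a ∧ b) → T a × T b
T-∧-elim a = Equivalence.to (T-∧ {a})

T-∧-intro : ∀ a {b} → T a → T b → T (a ∧ b)
T-∧-intro a ta tb = Equivalence.from (T-∧ {a}) (ta , tb)

T-∨-elim : ∀ a {b} → T (a ∨ b) → T a ⊎ T b
T-∨-elim a = Equivalence.to (T-∨ {a})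

T-∨-introˡ : ∀ a {b} → T a → T (a ∨ b)
T-∨-introˡ a = Equivalence.from (T-∨ {a}) ∘ inj₁

T-∨-introʳ : ∀ a {b} → T b → T (a ∨ b)
T-∨-introʳ a = Equivalence.from (T-∨ {a}) ∘ inj₂

anyFin-false : ∀ {m} (p : Fin m → Bool) → (∀ i → p i ≡ false) → anyFin p ≡ false
anyFin-false {zero}  p _ = refl
anyFin-false {suc m} p all-false rewrite all-false zero = anyFin-false (p ∘ suc) (all-false ∘ suc)

indicator : Bool → ℕ
indicator false = 0
indicator true  = 1

indicator≡0 : ∀ {b} → indicator b ≡ 0 → b ≡ false
indicator≡0 {false} _ = refl

indicator≡1 : ∀ {b} → indicator b ≡ 1 → T b
indicator≡1 {true} _ = _

if-injective : {A : Set} {a b : A} → a ≢ b → ∀ s t → (if s then b else a) ≡ (if t then b else a) → s ≡ t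
if-injective a≢b false false _  = refl
if-injective a≢b false true  eq = ⊥-elim (a≢b eq)
if-injective a≢b true  false eq = ⊥-elim (a≢b (sym eq))
if-injective a≢b true  true  _  = refl

if-choice : {A : Set} {a b c : A} → c ≡ a ⊎ c ≡ b → Σ Bool λ s → (if s then b else a) ≡ c
if-choice (inj₁ refl) = false , refl
if-choice (inj₂ refl) = true , refl

mk↔-bijective : {A B : Set} (h : A → B) → Injective _≡_ _≡_ h → StrictlySurjective _≡_ h → A ↔ B
mk↔-bijective h inj sur = ⤖⇒↔ (mk⤖ (inj , strictlySurjective⇒surjective sur))

Subtype : (A : Set) → (A → Bool) → Set
Subtype A p = Σ A (T ∘ p)

Subtype-≡ : {A : Set} {p : A → Bool} {x y : A} {tx : T (p x)} {ty : T (p y)} →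
            x ≡ y → _≡_ {A = Subtype A p} (x , tx) (y , ty)
Subtype-≡ {tx = tx} {ty} refl = cong (_ ,_) (T-irrelevant tx ty)

count : ∀ {N} → (Fin N → Bool) → ℕ
count {zero}  p = 0
count {suc N} p = indicator (p zero) + count (p ∘ suc)

T↔Fin-indicator : ∀ b → T b ↔ Fin (indicator b)
T↔Fin-indicator false = ↔-sym 0↔⊥
T↔Fin-indicator true  = ↔-sym 1↔⊤

Subtype-Fin-suc : ∀ {N} (p : Fin (suc N) → Bool) →
                  Subtype (Fin (suc N)) p ↔ (T (p zero) ⊎ Subtype (Fin N) (p ∘ suc))
Subtype-Fin-suc p = mk↔ₛ′
  (λ { (zero , t) → inj₁ t ; (suc i , t) → inj₂ (i , t) })
  [ zero ,_ , (λ (i , t) → suc i , t) ]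
  (λ { (inj₁ _) → refl ; (inj₂ _) → refl })
  (λ { (zero , _) → refl ; (suc _ , _) → refl })

Subtype-Fin-size : ∀ {N} (p : Fin N → Bool) → Subtype (Fin N) p ↔ Fin (count p)
Subtype-Fin-size {zero}  p = mk↔ₛ′ (λ { (() , _) }) (λ ()) (λ ()) (λ { (() , _) })
Subtype-Fin-size {suc N} p =
  ↔-trans (Subtype-Fin-suc p)
    (↔-trans (T↔Fin-indicator (p zero) ⊎-↔ Subtype-Fin-size (p ∘ suc)) (↔-sym +↔⊎))

Subtype-transport : {A B : Set} (φ : A ↔ B) (p : A → Bool) → Subtype A p ↔ Subtype B (p ∘ Inverse.from φ)
Subtype-transport φ p = mk↔ₛ′
  (λ (a , t) → to a , subst′ t)
  (λ (b , t) → from b , t)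
  (λ (b , _) → Subtype-≡ (strictlyInverseˡ b))
  (λ (a , _) → Subtype-≡ (strictlyInverseʳ a))
  where
  open Inverse φ
  subst′ : ∀ {a} → T (p a) → T (p (from (to a)))
  subst′ {a} t rewrite strictlyInverseʳ a = t

Subtype-size : {A : Set} {N : ℕ} (φ : A ↔ Fin N) (p : A → Bool) →
               Subtype A p ↔ Fin (count (p ∘ Inverse.from φ))
Subtype-size φ p = ↔-trans (Subtype-transport φ p) (Subtype-Fin-size _)

Subtype-remove-one : {A : Set} {m : ℕ} (φ : A ↔ Fin (suc m)) (a : A) (q : A → Bool) →
                     (∀ x → T (q x) → x ≢ a) → (∀ x → x ≢ a → T (q x)) → Subtype A q ↔ Fin m
Subtype-remove-one {A} φ a q q⇒≢ ≢⇒q = mk↔ₛ′ to′ from′ to∘from from∘to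
  where
  open Inverse φ
  to-injective : ∀ {x y} → to x ≡ to y → x ≡ y
  to-injective = Injection.injective (Inverse⇒Injection φ)
  avoids : (x : Subtype A q) → to a ≢ to (proj₁ x)
  avoids (x , t) eq = q⇒≢ x t (sym (to-injective eq))
  to′ : Subtype A q → Fin _
  to′ x = punchOut (avoids x)
  from′ : Fin _ → Subtype A q
  from′ j = from (punchIn (to a) j) , ≢⇒q _ λ eq →
    punchInᵢ≢i (to a) j (trans (sym (strictlyInverseˡ _)) (cong to eq))
  to∘from : ∀ j → to′ (from′ j) ≡ j
  to∘from j = trans (punchOut-cong (to a) (strictlyInverseˡ _)) (punchOut-punchIn (to a))
  from∘to : ∀ x → from′ (to′ x) ≡ x
  from∘to (x , t) = Subtype-≡ (trans (cong from (punchIn-punchOut (avoids (x , t)))) (strictlyInverseʳ x))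

Bool²↔Fin4 : (Bool × Bool) ↔ Fin 4
Bool²↔Fin4 = ↔-trans (↔-sym 2↔Bool ×-↔ ↔-sym 2↔Bool) (↔-sym *↔×)

↔Fin1-irrelevant : {A : Set} → A ↔ Fin 1 → (a b : A) → a ≡ b
↔Fin1-irrelevant φ a b = Injection.injective (Inverse⇒Injection (↔-trans φ 1↔⊤)) refl

two-elements : ∀ {A : Set} {m} → A ↔ Fin m → 1 < m → Σ A λ a → Σ A λ b → a ≢ b
two-elements φ (s≤s (s≤s _)) =
  Inverse.from φ 0F , Inverse.from φ 1F , 0≢1+n ∘ Injection.injective (Inverse⇒Injection (↔-sym φ))

CyclicDistance≤2 : (m : ℕ) .{{_ : NonZero m}} → Set
CyclicDistance≤2 m = ∀ (i j : Fin m) →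
  i ≡ j ⊎ j ≡ next i ⊎ i ≡ next j ⊎ j ≡ next (next i) ⊎ i ≡ next (next j)

cyclicDistance≤2? : (m : ℕ) .{{_ : NonZero m}} → Dec (CyclicDistance≤2 m)
cyclicDistance≤2? m = all? λ i → all? λ j →
  i ≟ j ⊎-dec j ≟ next i ⊎-dec i ≟ next j ⊎-dec j ≟ next (next i) ⊎-dec i ≟ next (next j)

cyclicDistance≤2-4 : CyclicDistance≤2 4
cyclicDistance≤2-4 = toWitness {a? = cyclicDistance≤2? 4} _

cyclicDistance≤2-5 : CyclicDistance≤2 5
cyclicDistance≤2-5 = toWitness {a? = cyclicDistance≤2? 5} _

next⁴-4 : (i : Fin 4) → next (next (next (next i))) ≡ i
next⁴-4 0F = refl
next⁴-4 1F = refl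
next⁴-4 2F = refl
next⁴-4 3F = refl

next⁵-5 : (i : Fin 5) → next (next (next (next (next i)))) ≡ i
next⁵-5 0F = refl
next⁵-5 1F = refl
next⁵-5 2F = refl
next⁵-5 3F = refl
next⁵-5 4F = refl

reachable-trans : ∀ {A : Set} {R : Adjacency A} {a b c} → Reachable R a b → Reachable R b c → Reachable R a c
reachable-trans here         q = q
reachable-trans (step ab bc) q = step ab (reachable-trans bc q)

TriangleFree : ∀ {n} → Adjacency (Fin n) → Set
TriangleFree adj = ∀ x y z → T (adj x y) → T (adj y z) → T (adj x z) → ⊥

module SimpleGraph {n : ℕ} (adj : Adjacency (Fin n))
  (adj-sym : ∀ u v → adj u v ≡ adj v u) (adj-irrefl : ∀ v → adj v v ≡ false) where

  V : Set
  V = Fin n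

  E : Set
  E = Edge adj

  Adj : V → V → Set
  Adj u v = T (adj u v)

  Adj-sym : ∀ {u v} → Adj u v → Adj v u
  Adj-sym {u} {v} = subst T (adj-sym u v)

  Adj⇒≢ : ∀ {u v} → Adj u v → u ≢ v
  Adj⇒≢ {u} a refl = subst T (adj-irrefl u) a

  edge-adj : (e : E) → Adj (src e) (tgt e)
  edge-adj (_ , _ , _ , a) = a

  edge-≡ : (e f : E) → src e ≡ src f → tgt e ≡ tgt f → e ≡ f
  edge-≡ (u , v , l , a) (.u , .v , l′ , a′) refl refl =
    cong₂ (λ l a → u , v , l , a) (<-irrelevant l l′) (T-irrelevant a a′)

  _≟ₑ_ : (e f : E) → Dec (e ≡ f)
  e ≟ₑ f with src e ≟ src f | tgt e ≟ tgt f
  ... | yes p | yes q = yes (edge-≡ e f p q)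
  ... | no ¬p | _     = no (¬p ∘ cong src)
  ... | yes _ | no ¬q = no (¬q ∘ cong tgt)

  data _∋_ (e : E) (x : V) : Set where
    src∋ : src e ≡ x → e ∋ x
    tgt∋ : tgt e ≡ x → e ∋ x

  data Joins (g : E) (x y : V) : Set where
    forward  : src g ≡ x → tgt g ≡ y → Joins g x y
    backward : src g ≡ y → tgt g ≡ x → Joins g x y

  joins-self : (g : E) → Joins g (src g) (tgt g)
  joins-self g = forward refl refl

  joins-sym : ∀ {g x y} → Joins g x y → Joins g y x
  joins-sym (forward s t)  = backward s t
  joins-sym (backward s t) = forward s t

  joins-adj : ∀ {g x y} → Joins g x y → Adj x y
  joins-adj {g} (forward refl refl)  = edge-adj g
  joins-adj {g} (backward refl refl) = Adj-sym (edge-adj g)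

  joins-∋ˡ : ∀ {g x y} → Joins g x y → g ∋ x
  joins-∋ˡ (forward s _)  = src∋ s
  joins-∋ˡ (backward _ t) = tgt∋ t

  joins-∋ʳ : ∀ {g x y} → Joins g x y → g ∋ y
  joins-∋ʳ = joins-∋ˡ ∘ joins-sym

  joins-∋ : ∀ {g x y z} → Joins g x y → g ∋ z → z ≡ x ⊎ z ≡ y
  joins-∋ (forward refl refl)  (src∋ refl) = inj₁ refl
  joins-∋ (forward refl refl)  (tgt∋ refl) = inj₂ refl
  joins-∋ (backward refl refl) (src∋ refl) = inj₂ refl
  joins-∋ (backward refl refl) (tgt∋ refl) = inj₁ refl

  joins-unique : ∀ {g h x y} → Joins g x y → Joins h x y → g ≡ h
  joins-unique {g} {h} (forward a b)  (forward c d)  = edge-≡ g h (trans a (sym c)) (trans b (sym d))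
  joins-unique {g} {h} (backward a b) (backward c d) = edge-≡ g h (trans a (sym c)) (trans b (sym d))
  joins-unique {_ , _ , l , _} {_ , _ , l′ , _} (forward refl refl) (backward refl refl) = ⊥-elim (<-asym l l′)
  joins-unique {_ , _ , l , _} {_ , _ , l′ , _} (backward refl refl) (forward refl refl) = ⊥-elim (<-asym l l′)

  joins-other-end : ∀ {g x y y′} → Joins g x y → Joins g x y′ → y ≡ y′
  joins-other-end (forward refl refl)  (forward _ refl)     = refl
  joins-other-end (forward refl refl)  (backward refl refl) = refl
  joins-other-end (backward refl refl) (forward refl refl)  = refl
  joins-other-end (backward refl refl) (backward refl _)    = refl

  ∋-other-end : ∀ {g x} → g ∋ x → Σ V (Joins g x)
  ∋-other-end {g} (src∋ refl) = tgt g , forward refl refl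
  ∋-other-end {g} (tgt∋ refl) = src g , backward refl refl

  ∋-∋-joins : ∀ {g x y} → g ∋ x → g ∋ y → x ≢ y → Joins g x y
  ∋-∋-joins (src∋ refl) (src∋ refl) x≢y = ⊥-elim (x≢y refl)
  ∋-∋-joins (src∋ refl) (tgt∋ refl) _   = forward refl refl
  ∋-∋-joins (tgt∋ refl) (src∋ refl) _   = backward refl refl
  ∋-∋-joins (tgt∋ refl) (tgt∋ refl) x≢y = ⊥-elim (x≢y refl)

  Joins⇒edgeJoins : ∀ {g x y} → Joins g x y → T (edgeJoins g x y)
  Joins⇒edgeJoins {g} {x} {y} (forward s t)  =
    T-∨-introˡ (src g == x ∧ tgt g == y) (T-∧-intro (src g == x) (fromWitness s) (fromWitness t))
  Joins⇒edgeJoins {g} {x} {y} (backward s t) =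
    T-∨-introʳ (src g == x ∧ tgt g == y) (T-∧-intro (src g == y) (fromWitness s) (fromWitness t))

  edgeJoins⇒Joins : ∀ {g x y} → T (edgeJoins g x y) → Joins g x y
  edgeJoins⇒Joins {g} {x} {y} j with T-∨-elim (src g == x ∧ tgt g == y) j
  ... | inj₁ st = let (s , t) = T-∧-elim (src g == x) st in forward (toWitness s) (toWitness t)
  ... | inj₂ st = let (s , t) = T-∧-elim (src g == y) st in backward (toWitness s) (toWitness t)

  edgeBetween : (x y : V) → Adj x y → E
  edgeBetween x y a with <-cmp x y
  ... | tri< x<y _ _ = x , y , x<y , a
  ... | tri≈ _ x≡y _ = ⊥-elim (Adj⇒≢ a x≡y)
  ... | tri> _ _ y<x = y , x , y<x , Adj-sym a

  edgeBetween-joins : ∀ {x y} (a : Adj x y) → Joins (edgeBetween x y a) x y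
  edgeBetween-joins {x} {y} a with <-cmp x y
  ... | tri< _ _ _   = forward refl refl
  ... | tri≈ _ x≡y _ = ⊥-elim (Adj⇒≢ a x≡y)
  ... | tri> _ _ _   = backward refl refl

  Edge-finite : ∃[ m ] HasSize E m
  Edge-finite = _ , ↔-trans as-pairs (Subtype-size (↔-sym *↔×) _)
    where
    as-pairs : E ↔ Subtype (V × V) (λ (u , v) → ⌊ u <? v ⌋ ∧ adj u v)
    as-pairs = mk↔ₛ′
      (λ (u , v , u<v , a) → (u , v) , T-∧-intro (⌊ u <? v ⌋) (fromWitness u<v) a)
      (λ ((u , v) , t) → let (u<v , a) = T-∧-elim (⌊ u <? v ⌋) t in u , v , toWitness u<v , a)
      (λ _ → Subtype-≡ refl)
      (λ e → edge-≡ _ e refl refl)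

  Nbr : V → Set
  Nbr x = Subtype V (adj x)

  Nbr-except : V → V → Set
  Nbr-except x a = Subtype (Nbr x) (λ w → not (proj₁ w == a))

  Nbr-except₂ : V → V → V → Set
  Nbr-except₂ x a b = Subtype (Nbr x) (λ w → not (proj₁ w == a) ∧ not (proj₁ w == b))

  edge-at : ∀ {x} → Nbr x → E
  edge-at {x} (w , xw) = edgeBetween x w xw

  edge-at-joins : ∀ {x} (w : Nbr x) → Joins (edge-at w) x (proj₁ w)
  edge-at-joins (_ , xw) = edgeBetween-joins xw

  edge-at-injective : ∀ {x} {w w′ : Nbr x} → edge-at w ≡ edge-at w′ → w ≡ w′
  edge-at-injective {w = w} {w′} same =
    Subtype-≡ (joins-other-end (subst (λ g → Joins g _ _) same (edge-at-joins w)) (edge-at-joins w′))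

  edge-at-surjective : ∀ {g x} → g ∋ x → Σ (Nbr x) λ w → edge-at w ≡ g
  edge-at-surjective gx =
    let (w , g-xw) = ∋-other-end gx in (w , joins-adj g-xw) , joins-unique (edgeBetween-joins _) g-xw

  other-nbr⇒other-edge : ∀ {e x a} (w : Nbr x) → Joins e x a → T (not (proj₁ w == a)) → e ≢ edge-at w
  other-nbr⇒other-edge w e-xa w≢a refl = toWitnessFalse w≢a (sym (joins-other-end e-xa (edge-at-joins w)))

  other-edge⇒other-nbr : ∀ {e g x a} → Joins e x a → g ≢ e → (w : Nbr x) → edge-at w ≡ g → T (not (proj₁ w == a))
  other-edge⇒other-nbr e-xa g≢e w refl =
    fromWitnessFalse λ w≡a → g≢e (joins-unique (subst (Joins (edge-at w) _) w≡a (edge-at-joins w)) e-xa)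

  ShareEnd : E → E → Set
  ShareEnd e f = Σ V λ x → e ∋ x × f ∋ x

  shareVertex⇒ : ∀ {e f} → T (shareVertex e f) → e ≢ f × ShareEnd e f
  shareVertex⇒ {e} {f} t = e≢f , common (T-∨-elim ss shared)
    where
    ss = src e == src f
    st = src e == tgt f
    ts = tgt e == src f
    tt = tgt e == tgt f
    distinct-shared = T-∧-elim (not (ss ∧ tt)) t
    shared = proj₂ distinct-shared
    e≢f : e ≢ f
    e≢f refl = subst T (Equivalence.to T-not-≡ (proj₁ distinct-shared))
                 (T-∧-intro ss (fromWitness refl) (fromWitness refl))
    common : T ss ⊎ T (st ∨ ts ∨ tt) → ShareEnd e f
    common (inj₁ p) = src e , src∋ refl , src∋ (sym (toWitness p))
    common (inj₂ q) with T-∨-elim st q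
    ... | inj₁ p = src e , src∋ refl , tgt∋ (sym (toWitness p))
    ... | inj₂ r with T-∨-elim ts r
    ...   | inj₁ p = tgt e , tgt∋ refl , src∋ (sym (toWitness p))
    ...   | inj₂ p = tgt e , tgt∋ refl , tgt∋ (sym (toWitness p))

  shareVertex⇐ : ∀ {e f x} → e ≢ f → e ∋ x → f ∋ x → T (shareVertex e f)
  shareVertex⇐ {e} {f} e≢f ex fx = T-∧-intro (not (ss ∧ tt)) distinct (shared ex fx)
    where
    ss = src e == src f
    st = src e == tgt f
    ts = tgt e == src f
    tt = tgt e == tgt f
    distinct : T (not (ss ∧ tt))
    distinct = Equivalence.from T-not-≡ (¬T⇒≡false λ t →
      let (s≡s , t≡t) = T-∧-elim ss t in e≢f (edge-≡ e f (toWitness s≡s) (toWitness t≡t)))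
    shared : ∀ {x} → e ∋ x → f ∋ x → T (ss ∨ st ∨ ts ∨ tt)
    shared (src∋ p) (src∋ q) = T-∨-introˡ ss (fromWitness (trans p (sym q)))
    shared (src∋ p) (tgt∋ q) = T-∨-introʳ ss (T-∨-introˡ st (fromWitness (trans p (sym q))))
    shared (tgt∋ p) (src∋ q) = T-∨-introʳ ss (T-∨-introʳ st (T-∨-introˡ ts (fromWitness (trans p (sym q)))))
    shared (tgt∋ p) (tgt∋ q) = T-∨-introʳ ss (T-∨-introʳ st (T-∨-introʳ ts (fromWitness (trans p (sym q)))))

  record Disjoint (e f : E) : Set where
    constructor disjoint
    field no-shared-end : ¬ ShareEnd e f

  nonAdjacent⇒disjoint : ∀ {e f} → NonAdjacentEdges {adj = adj} e f → Disjoint e f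
  nonAdjacent⇒disjoint (ss , st , ts , tt) = disjoint λ where
    (_ , src∋ p , src∋ q) → ss (trans p (sym q))
    (_ , src∋ p , tgt∋ q) → st (trans p (sym q))
    (_ , tgt∋ p , src∋ q) → ts (trans p (sym q))
    (_ , tgt∋ p , tgt∋ q) → tt (trans p (sym q))

  disjoint⇒nonAdjacent : ∀ {e f} → Disjoint e f → NonAdjacentEdges {adj = adj} e f
  disjoint⇒nonAdjacent (disjoint no-shared-end) =
    (λ p → no-shared-end (_ , src∋ refl , src∋ (sym p))) ,
    (λ p → no-shared-end (_ , src∋ refl , tgt∋ (sym p))) ,
    (λ p → no-shared-end (_ , tgt∋ refl , src∋ (sym p))) ,
    (λ p → no-shared-end (_ , tgt∋ refl , tgt∋ (sym p)))

  joins-disjoint : ∀ {e f a b c d} → Joins e a b → Joins f c d →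
                   a ≢ c → a ≢ d → b ≢ c → b ≢ d → Disjoint e f
  joins-disjoint {a = a} {b} {c} {d} e-ab f-cd a≢c a≢d b≢c b≢d = disjoint λ (z , ez , fz) →
    case (joins-∋ e-ab ez) (joins-∋ f-cd fz)
    where
    case : ∀ {z} → z ≡ a ⊎ z ≡ b → z ≡ c ⊎ z ≡ d → ⊥
    case (inj₁ refl) (inj₁ refl) = a≢c refl
    case (inj₁ refl) (inj₂ refl) = a≢d refl
    case (inj₂ refl) (inj₁ refl) = b≢c refl
    case (inj₂ refl) (inj₂ refl) = b≢d refl

  ends-≢ : ∀ {e f a b} → Disjoint e f → e ∋ a → f ∋ b → a ≢ b
  ends-≢ e∥f ea fb refl = Disjoint.no-shared-end e∥f (_ , ea , fb)

  joins-aligned : ∀ {e f g a b a′ b′} → Disjoint e f → e ∋ a → f ∋ b → e ∋ a′ → f ∋ b′ →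
                  Joins g a b → Joins g a′ b′ → a ≡ a′ × b ≡ b′
  joins-aligned e∥f ea fb ea′ fb′ g-ab g-a′b′
    with joins-∋ g-ab (joins-∋ˡ g-a′b′) | joins-∋ g-ab (joins-∋ʳ g-a′b′)
  ... | inj₂ refl | _         = ⊥-elim (ends-≢ e∥f ea′ fb refl)
  ... | _         | inj₁ refl = ⊥-elim (ends-≢ e∥f ea fb′ refl)
  ... | inj₁ refl | inj₂ refl = refl , refl

  record Linked (e f : E) : Set where
    constructor linked
    field
      {x x′ y y′} : V
      e-joins : Joins e x x′
      f-joins : Joins f y y′
      link    : Adj x y

  Matched : E → E → Set
  Matched e f = Σ (Linked e f) λ l → Adj (Linked.x′ l) (Linked.y′ l)

  closed-walk⇒cycle : ∀ {m} .{{_ : NonZero m}} → CyclicDistance≤2 m → (v : Fin m → V) →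
                      (∀ i → Adj (v i) (v (next i))) → (∀ i → v i ≢ v (next (next i))) → Cycle adj m
  closed-walk⇒cycle near v adjacent apart = record { vert = v ; injective = injective ; adjacent = adjacent }
    where
    injective : ∀ i j → v i ≡ v j → i ≡ j
    injective i j vi≡vj with near i j
    ... | inj₁ i≡j                       = i≡j
    ... | inj₂ (inj₁ refl)               = ⊥-elim (Adj⇒≢ (adjacent i) vi≡vj)
    ... | inj₂ (inj₂ (inj₁ refl))        = ⊥-elim (Adj⇒≢ (adjacent j) (sym vi≡vj))
    ... | inj₂ (inj₂ (inj₂ (inj₁ refl))) = ⊥-elim (apart i vi≡vj)
    ... | inj₂ (inj₂ (inj₂ (inj₂ refl))) = ⊥-elim (apart j (sym vi≡vj))

  matched-cycle4 : ∀ {e f} → Disjoint e f → Matched e f → InCommonCycle adj 4 e f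
  matched-cycle4 {e} {f} e∥f (linked {x} {x′} {y} {y′} e-xx′ f-yy′ xy , x′y′) =
    closed-walk⇒cycle cyclicDistance≤2-4 v adjacent apart ,
    (0F , Joins⇒edgeJoins e-xx′) , (2F , Joins⇒edgeJoins (joins-sym f-yy′))
    where
    v : Fin 4 → V
    v 0F = x
    v 1F = x′
    v 2F = y′
    v 3F = y
    adjacent : ∀ i → Adj (v i) (v (next i))
    adjacent 0F = joins-adj e-xx′
    adjacent 1F = x′y′
    adjacent 2F = joins-adj (joins-sym f-yy′)
    adjacent 3F = Adj-sym xy
    apart : ∀ i → v i ≢ v (next (next i))
    apart 0F = ends-≢ e∥f (joins-∋ˡ e-xx′) (joins-∋ʳ f-yy′)
    apart 1F = ends-≢ e∥f (joins-∋ʳ e-xx′) (joins-∋ˡ f-yy′)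
    apart 2F = ends-≢ e∥f (joins-∋ˡ e-xx′) (joins-∋ʳ f-yy′) ∘ sym
    apart 3F = ends-≢ e∥f (joins-∋ʳ e-xx′) (joins-∋ˡ f-yy′) ∘ sym

  cycle4⇒matched : ∀ {e f} → Disjoint e f → InCommonCycle adj 4 e f → Matched e f
  cycle4⇒matched {e} {f} e∥f (c , (i , ei) , (j , fj)) =
    positions (cyclicDistance≤2-4 i j) (edgeJoins⇒Joins ei) (edgeJoins⇒Joins fj)
    where
    open Cycle c
    clash : ∀ {a b} → e ∋ a → f ∋ b → a ≡ b → Matched e f
    clash ea fb a≡b = ⊥-elim (ends-≢ e∥f ea fb a≡b)
    opposite : ∀ i j → j ≡ next (next i) → Joins e (vert i) (vert (next i)) → Joins f (vert j) (vert (next j)) →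
               Matched e f
    opposite i j refl e-i f-j =
      linked (joins-sym e-i) f-j (adjacent (next i)) ,
      subst (λ k → Adj (vert k) (vert (next j))) (next⁴-4 i) (Adj-sym (adjacent (next j)))
    positions : ∀ {i j} → i ≡ j ⊎ j ≡ next i ⊎ i ≡ next j ⊎ j ≡ next (next i) ⊎ i ≡ next (next j) →
                Joins e (vert i) (vert (next i)) → Joins f (vert j) (vert (next j)) → Matched e f
    positions (inj₁ refl)                e-i f-j = clash (joins-∋ˡ e-i) (joins-∋ˡ f-j) refl
    positions (inj₂ (inj₁ refl))         e-i f-j = clash (joins-∋ʳ e-i) (joins-∋ˡ f-j) refl
    positions (inj₂ (inj₂ (inj₁ refl)))  e-i f-j = clash (joins-∋ˡ e-i) (joins-∋ʳ f-j) refl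
    positions {i} {j} (inj₂ (inj₂ (inj₂ (inj₁ j≡i+2)))) e-i f-j = opposite i j j≡i+2 e-i f-j
    positions {i} {j} (inj₂ (inj₂ (inj₂ (inj₂ i≡j+2)))) e-i f-j =
      opposite i j (trans (sym (next⁴-4 j)) (cong (next ∘ next) (sym i≡j+2))) e-i f-j

  module TriangleFreeGraph (triangle-free : TriangleFree adj) where

    Γ : Adjacency E
    Γ = gallai adj

    commonTriangle≡false : ∀ e f → commonTriangle adj e f ≡ false
    commonTriangle≡false e f =
      anyFin-false _ λ x → anyFin-false _ λ y → anyFin-false _ λ z → ¬T⇒≡false λ t →
        let (xy , t′) = T-∧-elim (adj x y) t
            (yz , t″) = T-∧-elim (adj y z) t′
        in triangle-free x y z xy yz (proj₁ (T-∧-elim (adj x z) t″))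

    gallai≡shareVertex : ∀ e f → Γ e f ≡ shareVertex e f
    gallai≡shareVertex e f rewrite commonTriangle≡false e f = ∧-identityʳ _

    Γ-adjacent⇒ : ∀ {e f} → T (Γ e f) → e ≢ f × ShareEnd e f
    Γ-adjacent⇒ {e} {f} = shareVertex⇒ ∘ subst T (gallai≡shareVertex e f)

    Γ-adjacent⇐ : ∀ {e f x} → e ≢ f → e ∋ x → f ∋ x → T (Γ e f)
    Γ-adjacent⇐ {e} {f} e≢f ex fx = subst T (sym (gallai≡shareVertex e f)) (shareVertex⇐ e≢f ex fx)

    Γ-nonadjacent⇒disjoint : ∀ {e f} → e ≢ f → Γ e f ≡ false → Disjoint e f
    Γ-nonadjacent⇒disjoint e≢f Γef≡false =
      disjoint λ (_ , ex , fx) → subst T Γef≡false (Γ-adjacent⇐ e≢f ex fx)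

    disjoint⇒Γ-nonadjacent : ∀ {e f} → Disjoint e f → Γ e f ≡ false
    disjoint⇒Γ-nonadjacent {e} {f} e∥f =
      ¬T⇒≡false λ t → Disjoint.no-shared-end e∥f (proj₂ (Γ-adjacent⇒ {e} {f} t))

    disjoint⇒≢ : ∀ {e f} → Disjoint e f → e ≢ f
    disjoint⇒≢ {e} e∥f refl = Disjoint.no-shared-end e∥f (src e , src∋ refl , src∋ refl)

    Γ-reachable-at : ∀ {e f x} → e ∋ x → f ∋ x → Reachable Γ e f
    Γ-reachable-at {e} {f} ex fx with e ≟ₑ f
    ... | yes refl = here
    ... | no e≢f   = step (Γ-adjacent⇐ e≢f ex fx) here

    Γ-reachable : ∀ {x y} → Reachable adj x y → ∀ {e f} → e ∋ x → f ∋ y → Reachable Γ e f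
    Γ-reachable here              ex fy = Γ-reachable-at ex fy
    Γ-reachable (step {u} {v} a r) ex fy =
      reachable-trans (Γ-reachable-at ex (joins-∋ˡ uv)) (Γ-reachable r (joins-∋ʳ uv) fy)
      where uv = edgeBetween-joins a

    gallai-connected : IsConnected adj → IsConnected Γ
    gallai-connected connected e f = Γ-reachable (connected (src e) (src f)) (src∋ refl) (src∋ refl)

    closed-walk5⇒cycle : (v : Fin 5 → V) → (∀ i → Adj (v i) (v (next i))) → Cycle adj 5
    closed-walk5⇒cycle v adjacent = closed-walk⇒cycle cyclicDistance≤2-5 v adjacent apart
      where
      apart : ∀ i → v i ≢ v (next (next i))
      apart i vi≡vi₂ = triangle-free (v i₂) (v i₃) (v i₄) (adjacent i₂) (adjacent i₃)
        (Adj-sym (subst (Adj (v i₄)) (trans (cong v (next⁵-5 i)) vi≡vi₂) (adjacent i₄)))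
        where
        i₂ = next (next i)
        i₃ = next i₂
        i₄ = next i₃

    linked-cycle5 : ∀ {e f} (l : Linked e f) {z} → Adj (Linked.x′ l) z → Adj z (Linked.y′ l) →
                    InCommonCycle adj 5 e f
    linked-cycle5 (linked {x} {x′} {y} {y′} e-xx′ f-yy′ xy) {z} x′z zy′ =
      closed-walk5⇒cycle v adjacent , (0F , Joins⇒edgeJoins e-xx′) , (3F , Joins⇒edgeJoins (joins-sym f-yy′))
      where
      v : Fin 5 → V
      v 0F = x
      v 1F = x′
      v 2F = z
      v 3F = y′
      v 4F = y
      adjacent : ∀ i → Adj (v i) (v (next i))
      adjacent 0F = joins-adj e-xx′
      adjacent 1F = x′z
      adjacent 2F = zy′
      adjacent 3F = joins-adj (joins-sym f-yy′)
      adjacent 4F = Adj-sym xy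

    cycle5⇒linked : ∀ {e f} → Disjoint e f → InCommonCycle adj 5 e f → Linked e f
    cycle5⇒linked {e} {f} e∥f (c , (i , ei) , (j , fj)) =
      positions (cyclicDistance≤2-5 i j) (edgeJoins⇒Joins ei) (edgeJoins⇒Joins fj)
      where
      open Cycle c
      clash : ∀ {a b} → e ∋ a → f ∋ b → a ≡ b → Linked e f
      clash ea fb a≡b = ⊥-elim (ends-≢ e∥f ea fb a≡b)
      positions : ∀ {i j} → i ≡ j ⊎ j ≡ next i ⊎ i ≡ next j ⊎ j ≡ next (next i) ⊎ i ≡ next (next j) →
                  Joins e (vert i) (vert (next i)) → Joins f (vert j) (vert (next j)) → Linked e f
      positions (inj₁ refl)                        e-i f-j = clash (joins-∋ˡ e-i) (joins-∋ˡ f-j) refl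
      positions (inj₂ (inj₁ refl))                 e-i f-j = clash (joins-∋ʳ e-i) (joins-∋ˡ f-j) refl
      positions (inj₂ (inj₂ (inj₁ refl)))          e-i f-j = clash (joins-∋ˡ e-i) (joins-∋ʳ f-j) refl
      positions {i} (inj₂ (inj₂ (inj₂ (inj₁ refl)))) e-i f-j = linked (joins-sym e-i) f-j (adjacent (next i))
      positions {j = j} (inj₂ (inj₂ (inj₂ (inj₂ refl)))) e-i f-j =
        linked e-i (joins-sym f-j) (Adj-sym (adjacent (next j)))

    Γ-common-nbr-joins : ∀ {e f g} → Disjoint e f → T (Γ e g ∧ Γ f g) →
                         Σ V λ z → Σ V λ w → e ∋ z × f ∋ w × Joins g z w
    Γ-common-nbr-joins {e} {f} {g} e∥f eg∧fg =
      let (eg , fg) = T-∧-elim (Γ e g) eg∧fg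
          (_ , z , ez , gz) = Γ-adjacent⇒ {e} {g} eg
          (_ , w , fw , gw) = Γ-adjacent⇒ {f} {g} fg
      in z , w , ez , fw , ∋-∋-joins gz gw (ends-≢ e∥f ez fw)

    Γ-common-nbr⇒linked : ∀ {e f} → Disjoint e f → CommonNbrs Γ e f → Linked e f
    Γ-common-nbr⇒linked {e} {f} e∥f (g , eg∧fg) =
      let (z , w , ez , fw , g-zw) = Γ-common-nbr-joins {e} {f} {g} e∥f eg∧fg
      in linked (proj₂ (∋-other-end ez)) (proj₂ (∋-other-end fw)) (joins-adj g-zw)

    Γ-common-nbrs-linked : ∀ {e f} → Disjoint e f → (l : Linked e f) →
                           HasSize (CommonNbrs Γ e f) (suc (indicator (adj (Linked.x′ l) (Linked.y′ l))))
    Γ-common-nbrs-linked {e} {f} e∥f (linked {x} {x′} {y} {y′} e-xx′ f-yy′ xy) =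
      ↔-trans (↔-sym (mk↔-bijective cross-edge cross-edge-injective cross-edge-surjective))
        (subst (λ m → Subtype (Bool × Bool) cross ↔ Fin m) cross-count (Subtype-size Bool²↔Fin4 cross))
      where
      end-e end-f : Bool → V
      end-e s = if s then x′ else x
      end-f t = if t then y′ else y
      cross : Bool × Bool → Bool
      cross (s , t) = adj (end-e s) (end-f t)
      e∋end : ∀ s → e ∋ end-e s
      e∋end false = joins-∋ˡ e-xx′
      e∋end true  = joins-∋ʳ e-xx′
      f∋end : ∀ t → f ∋ end-f t
      f∋end false = joins-∋ˡ f-yy′
      f∋end true  = joins-∋ʳ f-yy′
      cross-count : count (cross ∘ Inverse.from Bool²↔Fin4) ≡ suc (indicator (adj x′ y′))
      cross-count
        rewrite Equivalence.to T-≡ xy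
              | ¬T⇒≡false (triangle-free x y y′ xy (joins-adj f-yy′))
              | ¬T⇒≡false (triangle-free x′ x y (Adj-sym (joins-adj e-xx′)) xy)
        = cong suc (+-identityʳ _)
      cross-edge : Subtype (Bool × Bool) cross → CommonNbrs Γ e f
      cross-edge ((s , t) , a) =
        g , T-∧-intro (Γ e g) (Γ-adjacent⇐ e≢g (e∋end s) (joins-∋ˡ g-joins))
                              (Γ-adjacent⇐ f≢g (f∋end t) (joins-∋ʳ g-joins))
        where
        g = edgeBetween (end-e s) (end-f t) a
        g-joins = edgeBetween-joins a
        e≢g : e ≢ g
        e≢g refl = ends-≢ e∥f (joins-∋ʳ g-joins) (f∋end t) refl
        f≢g : f ≢ g
        f≢g refl = ends-≢ e∥f (e∋end s) (joins-∋ˡ g-joins) refl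
      cross-edge-injective : Injective _≡_ _≡_ cross-edge
      cross-edge-injective {(s , t) , a} {(s′ , t′) , a′} same-edge =
        Subtype-≡ (cong₂ _,_ (if-injective (Adj⇒≢ (joins-adj e-xx′)) s s′ (proj₁ aligned))
                             (if-injective (Adj⇒≢ (joins-adj f-yy′)) t t′ (proj₂ aligned)))
        where
        aligned = joins-aligned e∥f (e∋end s) (f∋end t) (e∋end s′) (f∋end t′) (edgeBetween-joins a)
                    (subst (λ g → Joins g _ _) (sym (cong proj₁ same-edge)) (edgeBetween-joins a′))
      cross-edge-surjective : StrictlySurjective _≡_ cross-edge
      cross-edge-surjective (g , eg∧fg) with Γ-common-nbr-joins {e} {f} {g} e∥f eg∧fg
      ... | z , w , ez , fw , g-zw with if-choice (joins-∋ e-xx′ ez) | if-choice (joins-∋ f-yy′ fw)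
      ... | s , refl | t , refl =
        ((s , t) , joins-adj g-zw) , Subtype-≡ (joins-unique (edgeBetween-joins _) g-zw)

    module Regular {d : ℕ} (regular : IsRegular adj (suc (suc d))) where

      Nbr-except-size : ∀ {x a} → Adj x a → Nbr-except x a ↔ Fin (suc d)
      Nbr-except-size {x} {a} xa = Subtype-remove-one (regular x) (a , xa) _
        (λ w w≢a w≡a → toWitnessFalse w≢a (cong proj₁ w≡a))
        (λ w w≢a → fromWitnessFalse (w≢a ∘ Subtype-≡))

      Nbr-except₂-size : ∀ {x a b} → Adj x a → Adj x b → a ≢ b → Nbr-except₂ x a b ↔ Fin d
      Nbr-except₂-size {x} {a} {b} xa xb a≢b =
        ↔-trans regroup (Subtype-remove-one (Nbr-except-size xa) ((b , xb) , fromWitnessFalse (a≢b ∘ sym)) _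
          (λ w w≢b w≡b → toWitnessFalse w≢b (cong (proj₁ ∘ proj₁) w≡b))
          (λ w w≢b → fromWitnessFalse (w≢b ∘ Subtype-≡ ∘ Subtype-≡)))
        where
        regroup : Nbr-except₂ x a b ↔ Subtype (Nbr-except x a) (λ w → not (proj₁ (proj₁ w) == b))
        regroup = mk↔ₛ′
          (λ (w , t) → let (≢a , ≢b) = T-∧-elim (not (proj₁ w == a)) t in (w , ≢a) , ≢b)
          (λ ((w , ≢a) , ≢b) → w , T-∧-intro (not (proj₁ w == a)) ≢a ≢b)
          (λ _ → Subtype-≡ (Subtype-≡ refl))
          (λ _ → Subtype-≡ refl)

      Γ-degree : (e : E) → HasSize (Σ E (T ∘ Γ e)) (suc d + suc d)
      Γ-degree e = ↔-trans (↔-sym (mk↔-bijective other-edge injective surjective))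
                     (↔-trans (Nbr-except-size xy ⊎-↔ Nbr-except-size (Adj-sym xy)) (↔-sym +↔⊎))
        where
        x = src e
        y = tgt e
        xy = edge-adj e
        e-xy = joins-self e
        at : ∀ {u v} → Joins e u v → Nbr-except u v → Σ E (T ∘ Γ e)
        at e-uv (w , w≢v) =
          edge-at w , Γ-adjacent⇐ (other-nbr⇒other-edge w e-uv w≢v) (joins-∋ˡ e-uv) (joins-∋ˡ (edge-at-joins w))
        other-edge : Nbr-except x y ⊎ Nbr-except y x → Σ E (T ∘ Γ e)
        other-edge = [ at e-xy , at (joins-sym e-xy) ]
        at-x≢at-y : (w : Nbr-except x y) (w′ : Nbr-except y x) → edge-at (proj₁ w) ≢ edge-at (proj₁ w′)
        at-x≢at-y ((w , _) , w≢y) (w′ , _) same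
          with joins-∋ (edge-at-joins (w , _)) (subst (_∋ y) (sym same) (joins-∋ˡ (edge-at-joins w′)))
        ... | inj₁ y≡x = Adj⇒≢ xy (sym y≡x)
        ... | inj₂ y≡w = toWitnessFalse w≢y (sym y≡w)
        injective : Injective _≡_ _≡_ other-edge
        injective {inj₁ _} {inj₁ _} same = cong inj₁ (Subtype-≡ (edge-at-injective (cong proj₁ same)))
        injective {inj₂ _} {inj₂ _} same = cong inj₂ (Subtype-≡ (edge-at-injective (cong proj₁ same)))
        injective {inj₁ w} {inj₂ w′} same = ⊥-elim (at-x≢at-y w w′ (cong proj₁ same))
        injective {inj₂ w} {inj₁ w′} same = ⊥-elim (at-x≢at-y w′ w (cong proj₁ (sym same)))
        preimage : ∀ {u v g} (e-uv : Joins e u v) → g ≢ e → g ∋ u →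
                   Σ (Nbr-except u v) λ w → proj₁ (at e-uv w) ≡ g
        preimage e-uv g≢e gu =
          let (w , w≡g) = edge-at-surjective gu in (w , other-edge⇒other-nbr e-uv g≢e w w≡g) , w≡g
        surjective : StrictlySurjective _≡_ other-edge
        surjective (g , eg) with Γ-adjacent⇒ {e} {g} eg
        ... | e≢g , z , ez , gz with joins-∋ e-xy ez
        ...   | inj₁ refl = let (w , w≡g) = preimage e-xy (e≢g ∘ sym) gz in inj₁ w , Subtype-≡ w≡g
        ...   | inj₂ refl = let (w , w≡g) = preimage (joins-sym e-xy) (e≢g ∘ sym) gz in inj₂ w , Subtype-≡ w≡g

      -- Every common Γ-neighbour contains x: an edge a b would close the triangle x a b.
      Γ-common-nbrs-adjacent : ∀ {e f} → T (Γ e f) → HasSize (CommonNbrs Γ e f) d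
      Γ-common-nbrs-adjacent {e} {f} ef with Γ-adjacent⇒ {e} {f} ef
      ... | e≢f , x , ex , fx with ∋-other-end ex | ∋-other-end fx
      ... | a , e-xa | b , f-xb =
        ↔-trans (↔-sym (mk↔-bijective other-edge injective surjective))
          (Nbr-except₂-size (joins-adj e-xa) (joins-adj f-xb) a≢b)
        where
        a≢b : a ≢ b
        a≢b refl = e≢f (joins-unique e-xa f-xb)
        other-edge : Nbr-except₂ x a b → CommonNbrs Γ e f
        other-edge (w , w∉ab) =
          let (w≢a , w≢b) = T-∧-elim (not (proj₁ w == a)) w∉ab
          in edge-at w , T-∧-intro (Γ e (edge-at w))
                           (Γ-adjacent⇐ (other-nbr⇒other-edge w e-xa w≢a) ex (joins-∋ˡ (edge-at-joins w)))
                           (Γ-adjacent⇐ (other-nbr⇒other-edge w f-xb w≢b) fx (joins-∋ˡ (edge-at-joins w)))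
        injective : Injective _≡_ _≡_ other-edge
        injective same = Subtype-≡ (edge-at-injective (cong proj₁ same))
        preimage : ∀ {g} → g ≢ e → g ≢ f → g ∋ x → Σ (Nbr-except₂ x a b) λ w → proj₁ (other-edge w) ≡ g
        preimage g≢e g≢f gx =
          let (w , w≡g) = edge-at-surjective gx
          in (w , T-∧-intro (not (proj₁ w == a)) (other-edge⇒other-nbr e-xa g≢e w w≡g)
                                                 (other-edge⇒other-nbr f-xb g≢f w w≡g))
             , w≡g
        surjective : StrictlySurjective _≡_ other-edge
        surjective (g , eg∧fg) with T-∧-elim (Γ e g) eg∧fg
        ... | eg , fg with Γ-adjacent⇒ {e} {g} eg | Γ-adjacent⇒ {f} {g} fg
        ... | e≢g , y , ey , gy | f≢g , z , fz , gz with joins-∋ e-xa ey | joins-∋ f-xb fz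
        ... | inj₁ refl | _         = let (w , w≡g) = preimage (e≢g ∘ sym) (f≢g ∘ sym) gy in w , Subtype-≡ w≡g
        ... | inj₂ refl | inj₁ refl = let (w , w≡g) = preimage (e≢g ∘ sym) (f≢g ∘ sym) gz in w , Subtype-≡ w≡g
        ... | inj₂ refl | inj₂ refl =
          ⊥-elim (triangle-free x y z (joins-adj e-xa) (joins-adj (∋-∋-joins gy gz a≢b)) (joins-adj f-xb))

some-vertex : ∀ {n} (adj : Adjacency (Fin n)) → ¬ IsComplete adj → Fin n
some-vertex {zero}  adj not-complete = ⊥-elim (not-complete λ ())
some-vertex {suc n} adj _            = 0F

module TriangleFreeSRG {n : ℕ} (adj : Adjacency (Fin n))
  (adj-sym : ∀ u v → adj u v ≡ adj v u) (adj-irrefl : ∀ v → adj v v ≡ false)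
  {d μ : ℕ} (regular : IsRegular adj (suc (suc d))) (not-complete : ¬ IsComplete adj)
  (λ-nbrs : ∀ u v → T (adj u v) → HasSize (CommonNbrs adj u v) 0)
  (μ-nbrs : ∀ u v → u ≢ v → adj u v ≡ false → HasSize (CommonNbrs adj u v) μ) where

  open SimpleGraph adj adj-sym adj-irrefl

  triangle-free : TriangleFree adj
  triangle-free x y z xy yz xz = ¬Fin0 (Inverse.to (λ-nbrs x y xy) (z , T-∧-intro (adj x z) xz yz))

  open TriangleFreeGraph triangle-free public
  open Regular regular

  μ-common-nbr : ∀ {x y} → x ≢ y → adj x y ≡ false → Fin μ → Σ V λ z → Adj x z × Adj y z
  μ-common-nbr {x} {y} x≢y x≁y i =
    let (z , xz∧yz) = Inverse.from (μ-nbrs x y x≢y x≁y) i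
    in z , T-∧-elim (adj x z) xz∧yz

  u : V
  u = some-vertex adj not-complete

  v₁ : V
  v₁ = proj₁ (Inverse.from (regular u) 0F)

  uv₁ : Adj u v₁
  uv₁ = proj₂ (Inverse.from (regular u) 0F)

  v₂-except : Nbr-except u v₁
  v₂-except = Inverse.from (Nbr-except-size uv₁) 0F

  v₂ : V
  v₂ = proj₁ (proj₁ v₂-except)

  uv₂ : Adj u v₂
  uv₂ = proj₂ (proj₁ v₂-except)

  v₁≢v₂ : v₁ ≢ v₂
  v₁≢v₂ v₁≡v₂ = toWitnessFalse (proj₂ v₂-except) (sym v₁≡v₂)

  v₁≁v₂ : ¬ Adj v₁ v₂
  v₁≁v₂ = triangle-free v₁ u v₂ (Adj-sym uv₁) uv₂

  μ≢0 : μ ≢ 0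
  μ≢0 refl = ¬Fin0 (Inverse.to (μ-nbrs v₁ v₂ v₁≢v₂ (¬T⇒≡false v₁≁v₂))
                      (u , T-∧-intro (adj v₁ u) (Adj-sym uv₁) (Adj-sym uv₂)))

  w-except : Nbr-except v₁ u
  w-except = Inverse.from (Nbr-except-size (Adj-sym uv₁)) 0F

  w : V
  w = proj₁ (proj₁ w-except)

  v₁w : Adj v₁ w
  v₁w = proj₂ (proj₁ w-except)

  e₀ f₀ : E
  e₀ = edgeBetween v₁ w v₁w
  f₀ = edgeBetween u v₂ uv₂

  l₀ : Linked e₀ f₀
  l₀ = linked (edgeBetween-joins v₁w) (edgeBetween-joins uv₂) (Adj-sym uv₁)

  e₀∥f₀ : Disjoint e₀ f₀
  e₀∥f₀ = joins-disjoint (edgeBetween-joins v₁w) (edgeBetween-joins uv₂)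
    (Adj⇒≢ (Adj-sym uv₁)) v₁≢v₂ (toWitnessFalse (proj₂ w-except)) λ w≡v₂ → v₁≁v₂ (subst (Adj v₁) w≡v₂ v₁w)

  Γ-not-complete : ¬ IsComplete Γ
  Γ-not-complete complete =
    subst T (disjoint⇒Γ-nonadjacent e₀∥f₀) (complete e₀ f₀ (disjoint⇒≢ e₀∥f₀))

  Γ-not-empty : ¬ IsEmpty Γ
  Γ-not-empty empty = subst T (empty uv₁-edge uv₂-edge) (Γ-adjacent⇐ distinct (joins-∋ˡ u-v₁) (joins-∋ˡ u-v₂))
    where
    uv₁-edge = edgeBetween u v₁ uv₁
    uv₂-edge = edgeBetween u v₂ uv₂
    u-v₁ = edgeBetween-joins uv₁
    u-v₂ = edgeBetween-joins uv₂
    distinct : uv₁-edge ≢ uv₂-edge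
    distinct same = v₁≢v₂ (joins-other-end (subst (λ g → Joins g u v₁) same u-v₁) u-v₂)

  μ≡1⇒unmatched : μ ≡ 1 → ∀ {e f} → Disjoint e f → ¬ Matched e f
  μ≡1⇒unmatched refl e∥f (linked {x} {x′} {y} {y′} e-xx′ f-yy′ xy , x′y′) =
    ends-≢ e∥f (joins-∋ʳ e-xx′) (joins-∋ˡ f-yy′) (cong proj₁ (↔Fin1-irrelevant φ x′-common y-common))
    where
    x≁y′ : ¬ Adj x y′
    x≁y′ = triangle-free x y y′ xy (joins-adj f-yy′)
    φ = μ-nbrs x y′ (ends-≢ e∥f (joins-∋ˡ e-xx′) (joins-∋ʳ f-yy′)) (¬T⇒≡false x≁y′)
    x′-common = x′ , T-∧-intro (adj x x′) (joins-adj e-xx′) (Adj-sym x′y′)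
    y-common  = y  , T-∧-intro (adj x y) xy (Adj-sym (joins-adj f-yy′))

  CN : E → E → Set
  CN = CommonNbrs Γ

  unmatched-size : μ ≡ 1 → ∀ {e f} → Disjoint e f → Linked e f → HasSize (CN e f) 1
  unmatched-size μ≡1 {e} {f} e∥f l = subst (HasSize (CN e f) ∘ suc ∘ indicator)
    (¬T⇒≡false λ x′y′ → μ≡1⇒unmatched μ≡1 e∥f (l , x′y′)) (Γ-common-nbrs-linked e∥f l)

  matched-size : ∀ {e f} → Disjoint e f → Matched e f → HasSize (CN e f) 2
  matched-size {e} {f} e∥f (l , x′y′) = subst (HasSize (CN e f) ∘ suc ∘ indicator)
    (Equivalence.to T-≡ x′y′) (Γ-common-nbrs-linked e∥f l)

  matched-pair : 1 < μ → Σ E λ e → Σ E λ f → Disjoint e f × Matched e f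
  matched-pair 1<μ =
    e₁ , f₁ ,
    joins-disjoint e₁-joins f₁-joins (Adj⇒≢ v₁z₂) v₁≢v₂ (z₁≢z₂ ∘ Subtype-≡) (Adj⇒≢ (Adj-sym v₂z₁)) ,
    linked e₁-joins f₁-joins v₁z₂ , Adj-sym v₂z₁
    where
    two = two-elements (μ-nbrs v₁ v₂ v₁≢v₂ (¬T⇒≡false v₁≁v₂)) 1<μ
    z₁ = proj₁ (proj₁ two)
    z₂ = proj₁ (proj₁ (proj₂ two))
    z₁≢z₂ = proj₂ (proj₂ two)
    v₁z₁ = proj₁ (T-∧-elim (adj v₁ z₁) (proj₂ (proj₁ two)))
    v₂z₁ = proj₂ (T-∧-elim (adj v₁ z₁) (proj₂ (proj₁ two)))
    v₁z₂ = proj₁ (T-∧-elim (adj v₁ z₂) (proj₂ (proj₁ (proj₂ two))))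
    v₂z₂ = proj₂ (T-∧-elim (adj v₁ z₂) (proj₂ (proj₁ (proj₂ two))))
    e₁ = edgeBetween v₁ z₁ v₁z₁
    f₁ = edgeBetween z₂ v₂ (Adj-sym v₂z₂)
    e₁-joins = edgeBetween-joins v₁z₁
    f₁-joins = edgeBetween-joins (Adj-sym v₂z₂)

  CycleConditions : Set
  CycleConditions = (μ ≡ 1 → ∀ e f → NonAdjacentEdges {adj = adj} e f → InCommonCycle adj 5 e f)
                  × (1 < μ → ∀ e f → NonAdjacentEdges {adj = adj} e f → InCommonCycle adj 4 e f)

  Γ-StronglyRegular : Set
  Γ-StronglyRegular = ∃[ n′ ] ∃[ k′ ] ∃[ λ′ ] ∃[ μ′ ] IsStronglyRegular Γ n′ k′ λ′ μ′

  Γ-edge-regular : ∃[ n′ ] ∃[ k′ ] ∃[ λ′ ] IsEdgeRegular Γ n′ k′ λ′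
  Γ-edge-regular = let (m , E-size) = Edge-finite in
    m , _ , _ , E-size , Γ-degree , λ e f → Γ-common-nbrs-adjacent {e} {f}

  uniform⇒Γ-srg : ∀ μ′ → (∀ {e f} → Disjoint e f → HasSize (CN e f) μ′) → Γ-StronglyRegular
  uniform⇒Γ-srg μ′ μ′-size = let (m , E-size) = Edge-finite in
    m , _ , _ , μ′ , E-size , Γ-degree , Γ-not-complete , Γ-not-empty ,
    (λ e f → Γ-common-nbrs-adjacent {e} {f}) ,
    λ e f e≢f Γef≡false → μ′-size (Γ-nonadjacent⇒disjoint e≢f Γef≡false)

  Γ-srg⇒uniform : Γ-StronglyRegular → ∀ {e₀ f₀ m} → Disjoint e₀ f₀ → HasSize (CN e₀ f₀) m →
                  ∀ {e f} → Disjoint e f → HasSize (CN e f) m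
  Γ-srg⇒uniform (_ , _ , _ , μ′ , _ , _ , _ , _ , _ , μ′-nbrs) e₀∥f₀ size₀ e∥f =
    ↔-trans (μ′-size e∥f) (↔-trans (↔-sym (μ′-size e₀∥f₀)) size₀)
    where
    μ′-size : ∀ {e f} → Disjoint e f → HasSize (CN e f) μ′
    μ′-size {e} {f} e∥f = μ′-nbrs e f (disjoint⇒≢ e∥f) (disjoint⇒Γ-nonadjacent e∥f)

  Γ-common-nbrs-size⇒linked : ∀ {e f m} → Disjoint e f → HasSize (CN e f) (suc m) →
                              Σ (Linked e f) λ l → indicator (adj (Linked.x′ l) (Linked.y′ l)) ≡ m
  Γ-common-nbrs-size⇒linked e∥f size =
    let l = Γ-common-nbr⇒linked e∥f (Inverse.from size 0F)
    in l , suc-injective (↔⇒≡ (↔-trans (↔-sym (Γ-common-nbrs-linked e∥f l)) size))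

  Γ-srg⇒cycles : Γ-StronglyRegular → CycleConditions
  Γ-srg⇒cycles srg = five , four
    where
    five : μ ≡ 1 → ∀ e f → NonAdjacentEdges {adj = adj} e f → InCommonCycle adj 5 e f
    five μ≡1 e f e∦f =
      let e∥f = nonAdjacent⇒disjoint {e} {f} e∦f
          size = Γ-srg⇒uniform srg e₀∥f₀ (unmatched-size μ≡1 e₀∥f₀ l₀) e∥f
          (l , x′≁y′) = Γ-common-nbrs-size⇒linked e∥f size
          x′≢y′ = ends-≢ e∥f (joins-∋ʳ (Linked.e-joins l)) (joins-∋ʳ (Linked.f-joins l))
          (z , x′z , y′z) = μ-common-nbr x′≢y′ (indicator≡0 x′≁y′) (subst Fin (sym μ≡1) 0F)
      in linked-cycle5 l x′z (Adj-sym y′z)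
    four : 1 < μ → ∀ e f → NonAdjacentEdges {adj = adj} e f → InCommonCycle adj 4 e f
    four 1<μ e f e∦f =
      let (e₁ , f₁ , e₁∥f₁ , m₁) = matched-pair 1<μ
          e∥f = nonAdjacent⇒disjoint {e} {f} e∦f
          size = Γ-srg⇒uniform srg e₁∥f₁ (matched-size e₁∥f₁ m₁) e∥f
          (l , x′y′) = Γ-common-nbrs-size⇒linked e∥f size
      in matched-cycle4 e∥f (l , indicator≡1 x′y′)

  cycles⇒Γ-srg : CycleConditions → Γ-StronglyRegular
  cycles⇒Γ-srg (five , four) with ℕ.<-cmp 1 μ
  ... | tri< 1<μ _ _ = uniform⇒Γ-srg 2 λ {e} {f} e∥f →
    matched-size e∥f (cycle4⇒matched e∥f (four 1<μ e f (disjoint⇒nonAdjacent e∥f)))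
  ... | tri≈ _ 1≡μ _ = uniform⇒Γ-srg 1 λ {e} {f} e∥f →
    unmatched-size (sym 1≡μ) e∥f (cycle5⇒linked e∥f (five (sym 1≡μ) e f (disjoint⇒nonAdjacent e∥f)))
  ... | tri> _ _ μ<1 = ⊥-elim (μ≢0 (n<1⇒n≡0 μ<1))

theorem3 : (n k μ : ℕ) (adj : Adjacency (Fin n)) →
    IsSimpleGraph adj → IsStronglyRegular adj n k 0 μ → IsConnected adj → 3 ≤ k →
    IsConnected (gallai adj)
    × (∃[ n′ ] ∃[ k′ ] ∃[ λ′ ] IsEdgeRegular (gallai adj) n′ k′ λ′)
    × ((∃[ n′ ] ∃[ k′ ] ∃[ λ′ ] ∃[ μ′ ] IsStronglyRegular (gallai adj) n′ k′ λ′ μ′)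
       ⇔ ((μ ≡ 1 → ∀ e f → NonAdjacentEdges {adj = adj} e f → InCommonCycle adj 5 e f)
          × (1 < μ → ∀ e f → NonAdjacentEdges {adj = adj} e f → InCommonCycle adj 4 e f)))
theorem3 n k μ adj (adj-sym , adj-irrefl) (_ , regular , not-complete , _ , λ-nbrs , μ-nbrs) connected
         (s≤s (s≤s _)) =
  gallai-connected connected , Γ-edge-regular , mk⇔ Γ-srg⇒cycles cycles⇒Γ-srg
  where
  open TriangleFreeSRG adj adj-sym adj-irrefl regular not-complete λ-nbrs μ-nbrs
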